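{- For all integers $a,b\geq 1$ there exists a shiftable $SMR(4b+2,2a(4b+2);4a,2)$.
   Context: A signed magic rectangle $SMR(m,n;r,s)$ is an $m\times n$ array, some of whose cells are filled with integers and the others empty, such that exactly $r$ cells in every row and exactly $s$ cells in every column are filled (so $mr=ns$), every element of $X$ appears exactly once in the array, and the sum of the entries of each row and of each column is zero, where (for $mr$ even) $X=\{\pm1,\pm2,\ldots,\pm mr/2\}$. An array is shiftable if every row and every column contains the same number of positive entries as negative entries. -}

module Defs where

open import Data.Nat using (ℕ; zero; suc; _*_; _≤_; _/_)
import Data.Nat as ℕ
open import Data.Integer using (ℤ; +_; ∣_∣) renaming (_+_ to _+ℤ_)
import Data.Integer as ℤ
open import Data.Fin using (Fin)
import Data.Fin as Fin
open import Data.Maybe using (Maybe; just; nothing)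
open import Data.Bool using (Bool; true; false)
open import Relation.Nullary.Decidable using (⌊_⌋)
open import Relation.Binary.PropositionalEquality using (_≡_)
import Data.Product

count : ∀ {n} → (Fin n → Bool) → ℕ
count {zero}  p = 0
count {suc n} p with p Fin.zero
... | true  = suc (count (λ i → p (Fin.suc i)))
... | false = count (λ i → p (Fin.suc i))

sumℕ : ∀ {n} → (Fin n → ℕ) → ℕ
sumℕ {zero}  f = 0
sumℕ {suc n} f = f Fin.zero ℕ.+ sumℕ (λ i → f (Fin.suc i))

sumℤ : ∀ {n} → (Fin n → ℤ) → ℤ
sumℤ {zero}  f = + 0
sumℤ {suc n} f = f Fin.zero +ℤ sumℤ (λ i → f (Fin.suc i))

-- a partially filled m × n array of integers (nothing = empty cell)
Array : ℕ → ℕ → Set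
Array m n = Fin m → Fin n → Maybe ℤ

filled : Maybe ℤ → Bool
filled (just _) = true
filled nothing  = false

isPos : Maybe ℤ → Bool
isPos (just x) = ⌊ + 1 ℤ.≤? x ⌋
isPos nothing  = false

isNeg : Maybe ℤ → Bool
isNeg (just x) = ⌊ x ℤ.≤? ℤ.- (+ 1) ⌋
isNeg nothing  = false

val : Maybe ℤ → ℤ
val (just x) = x
val nothing  = + 0

isEntry : ℤ → Maybe ℤ → Bool
isEntry x (just y) = ⌊ x ℤ.≟ y ⌋
isEntry x nothing  = false

InX : ℕ → ℤ → Set
InX k x = (1 ≤ ∣ x ∣) Data.Product.× (∣ x ∣ ≤ k)

record IsSMR (m n r s : ℕ) (A : Array m n) : Set where
  field
    rowFilled : ∀ i → count (λ j → filled (A i j)) ≡ r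
    colFilled : ∀ j → count (λ i → filled (A i j)) ≡ s
    sizes     : m * r ≡ n * s
    entriesInX : ∀ i j x → A i j ≡ just x → InX ((m * r) / 2) x
    eachOnce  : ∀ x → InX ((m * r) / 2) x →
                sumℕ (λ i → count (λ j → isEntry x (A i j))) ≡ 1
    rowSum    : ∀ i → sumℤ (λ j → val (A i j)) ≡ + 0
    colSum    : ∀ j → sumℤ (λ i → val (A i j)) ≡ + 0

Shiftable : ∀ {m n} → Array m n → Set
Shiftable {m} {n} A =
  (∀ i → count (λ j → isPos (A i j)) ≡ count (λ j → isNeg (A i j))) Data.Product.×
  (∀ j → count (λ i → isPos (A i j)) ≡ count (λ i → isNeg (A i j)))

-- A 2 × 4 block with rows (t+1, −(t+2), −(t+3), t+4) and (−(t+1), t+2, t+3, −(t+4)) has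
-- balanced rows and columns and uses each of ±(t+1), …, ±(t+4) once.  Placing a such blocks
-- side by side, with offsets t, t+4, …, gives a balanced 2 × 4a strip on ±(t+1), …, ±(t+4a);
-- placing 2b+1 strips block-diagonally, again with increasing offsets, gives the rectangle:
-- every row meets 4a cells, every column 2, and the value ranges of the pieces tile
-- {1, …, 4a(2b+1)}.
module Submission where

open import Defs
open import Data.Nat using (ℕ; _+_; _*_; _≤_)
open import Data.Product using (Σ; _×_)

open import Data.Nat using (zero; suc; _<_; _≤?_; _/_; z≤n; s≤s)
import Data.Nat.Properties as ℕ
open import Data.Nat.DivMod using (m*n/n≡m)
import Data.Nat.Tactic.RingSolver as ℕ-Solver
open import Data.Integer using (ℤ; +_; -[1+_]; ∣_∣; -_; _≟_) renaming (_+_ to _+ℤ_)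
import Data.Integer.Properties as ℤ
import Data.Integer.Tactic.RingSolver as ℤ-Solver
open import Data.Fin using (Fin; zero; suc; splitAt)
open import Data.Vec.Functional using (_++_)
open import Data.Bool using (Bool; true; false)
open import Data.Maybe using (Maybe; just; nothing)
open import Data.Product using (_,_)
open import Data.Sum using (_⊎_; inj₁; inj₂; [_,_])
import Data.Sum as Sum
open import Function using (_∘_)
open import Algebra.Properties.CommutativeSemigroup ℕ.+-commutativeSemigroup using (interchange)
open import Relation.Nullary using (¬_; yes; no; contradiction)
open import Relation.Nullary.Decidable using (isYes≗does; dec-true; dec-false)
open import Relation.Binary.PropositionalEquality
  using (_≡_; _≢_; refl; sym; trans; cong; cong₂; subst; subst₂; module ≡-Reasoning)

count-splitAt : ∀ m {n} (p : Fin m ⊎ Fin n → Bool) →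
  count (p ∘ splitAt m) ≡ count (p ∘ inj₁) + count (p ∘ inj₂)
count-splitAt zero    p = refl
count-splitAt (suc m) p with p (inj₁ zero)
... | true  = cong suc (count-splitAt m (p ∘ Sum.map₁ suc))
... | false = count-splitAt m (p ∘ Sum.map₁ suc)

sumℕ-splitAt : ∀ m {n} (f : Fin m ⊎ Fin n → ℕ) →
  sumℕ (f ∘ splitAt m) ≡ sumℕ (f ∘ inj₁) + sumℕ (f ∘ inj₂)
sumℕ-splitAt zero    f = refl
sumℕ-splitAt (suc m) f = trans (cong (_+_ (f (inj₁ zero))) (sumℕ-splitAt m (f ∘ Sum.map₁ suc)))
                               (sym (ℕ.+-assoc (f (inj₁ zero)) _ _))

sumℤ-splitAt : ∀ m {n} (f : Fin m ⊎ Fin n → ℤ) →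
  sumℤ (f ∘ splitAt m) ≡ sumℤ (f ∘ inj₁) +ℤ sumℤ (f ∘ inj₂)
sumℤ-splitAt zero    f = sym (ℤ.+-identityˡ _)
sumℤ-splitAt (suc m) f = trans (cong (f (inj₁ zero) +ℤ_) (sumℤ-splitAt m (f ∘ Sum.map₁ suc)))
                               (sym (ℤ.+-assoc (f (inj₁ zero)) _ _))

count-++ : ∀ {A : Set} {m n} (p : A → Bool) (f : Fin m → A) (g : Fin n → A) →
  count (p ∘ (f ++ g)) ≡ count (p ∘ f) + count (p ∘ g)
count-++ {m = m} p f g = count-splitAt m (p ∘ [ f , g ])

count-false : ∀ {n} → count {n} (λ _ → false) ≡ 0
count-false {zero}  = refl
count-false {suc n} = count-false {n}

1≤count : ∀ {n} (p : Fin n → Bool) j → p j ≡ true → 1 ≤ count p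
1≤count p zero    pj rewrite pj = s≤s z≤n
1≤count p (suc j) pj with p zero
... | true  = s≤s z≤n
... | false = 1≤count (p ∘ suc) j pj

sumℕ-cong : ∀ {n} {f g : Fin n → ℕ} → (∀ i → f i ≡ g i) → sumℕ f ≡ sumℕ g
sumℕ-cong {zero}  f≗g = refl
sumℕ-cong {suc n} f≗g = cong₂ _+_ (f≗g zero) (sumℕ-cong (f≗g ∘ suc))

sumℕ-+ : ∀ {n} (f g : Fin n → ℕ) → sumℕ (λ i → f i + g i) ≡ sumℕ f + sumℕ g
sumℕ-+ {zero}  f g = refl
sumℕ-+ {suc n} f g = trans (cong (_+_ (f zero + g zero)) (sumℕ-+ (f ∘ suc) (g ∘ suc)))
                           (interchange (f zero) (g zero) _ _)

sumℕ-zero : ∀ {n} → sumℕ {n} (λ _ → 0) ≡ 0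
sumℕ-zero {zero}  = refl
sumℕ-zero {suc n} = sumℕ-zero {n}

sumℤ-zero : ∀ {n} → sumℤ {n} (λ _ → + 0) ≡ + 0
sumℤ-zero {zero}  = refl
sumℤ-zero {suc n} = trans (ℤ.+-identityˡ _) (sumℤ-zero {n})

≤-sumℕ : ∀ {n} (f : Fin n → ℕ) i → f i ≤ sumℕ f
≤-sumℕ f zero    = ℕ.m≤m+n (f zero) _
≤-sumℕ f (suc i) = ℕ.≤-trans (≤-sumℕ (f ∘ suc) i) (ℕ.m≤n+m _ (f zero))

empty : ∀ {n} → Fin n → Maybe ℤ
empty _ = nothing

record Balanced {n} (r : ℕ) (ℓ : Fin n → Maybe ℤ) : Set where
  field
    filledCount : count (λ j → filled (ℓ j)) ≡ r
    posNeg      : count (λ j → isPos (ℓ j)) ≡ count (λ j → isNeg (ℓ j))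
    sumZero     : sumℤ (λ j → val (ℓ j)) ≡ + 0
open Balanced

Balanced-empty : ∀ {n} → Balanced 0 (empty {n})
Balanced-empty {n} = record
  { filledCount = count-false {n} ; posNeg = trans (count-false {n}) (sym (count-false {n}))
  ; sumZero = sumℤ-zero {n} }

Balanced-splitAt : ∀ m {n r r′} (ℓ : Fin m ⊎ Fin n → Maybe ℤ) →
  Balanced r (ℓ ∘ inj₁) → Balanced r′ (ℓ ∘ inj₂) → Balanced (r + r′) (ℓ ∘ splitAt m)
Balanced-splitAt m ℓ L R = record
  { filledCount = trans (count-splitAt m (filled ∘ ℓ)) (cong₂ _+_ (filledCount L) (filledCount R))
  ; posNeg      = begin
      count (isPos ∘ ℓ ∘ splitAt m)                     ≡⟨ count-splitAt m (isPos ∘ ℓ) ⟩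
      count (isPos ∘ ℓ ∘ inj₁) + count (isPos ∘ ℓ ∘ inj₂) ≡⟨ cong₂ _+_ (posNeg L) (posNeg R) ⟩
      count (isNeg ∘ ℓ ∘ inj₁) + count (isNeg ∘ ℓ ∘ inj₂) ≡⟨ count-splitAt m (isNeg ∘ ℓ) ⟨
      count (isNeg ∘ ℓ ∘ splitAt m)                     ∎
  ; sumZero     = trans (sumℤ-splitAt m (val ∘ ℓ)) (cong₂ _+ℤ_ (sumZero L) (sumZero R))
  }
  where open ≡-Reasoning

Balanced-padʳ : ∀ {m n r} {ℓ : Fin m → Maybe ℤ} → Balanced r ℓ → Balanced r (ℓ ++ empty {n})
Balanced-padʳ {m} {r = r} {ℓ} L =
  subst (λ k → Balanced k _) (ℕ.+-identityʳ r) (Balanced-splitAt m [ ℓ , empty ] L Balanced-empty)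

Balanced-padˡ : ∀ {m n r} {ℓ : Fin n → Maybe ℤ} → Balanced r ℓ → Balanced r (empty {m} ++ ℓ)
Balanced-padˡ {m} {ℓ = ℓ} L = Balanced-splitAt m [ empty , ℓ ] Balanced-empty L

record BalancedArray {m n} (r s : ℕ) (A : Array m n) : Set where
  field
    rows : ∀ i → Balanced r (A i)
    cols : ∀ j → Balanced s (λ i → A i j)
open BalancedArray

infixr 5 _‖_
_‖_ : ∀ {m n₁ n₂} → Array m n₁ → Array m n₂ → Array m (n₁ + n₂)
(A ‖ B) i = A i ++ B i

-- Defined column by column, so that both the rows and the columns of A ⊕ B are padded
-- lines of A or B up to reduction, once the relevant index is split.
infixr 5 _⊕_
_⊕_ : ∀ {m₁ m₂ n₁ n₂} → Array m₁ n₁ → Array m₂ n₂ → Array (m₁ + m₂) (n₁ + n₂)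
(A ⊕ B) i j = ((λ i₁ → (A i₁ ++ empty) j) ++ (λ i₂ → (empty ++ B i₂) j)) i

‖-BalancedArray : ∀ {m n₁ n₂ r₁ r₂ s} {A : Array m n₁} {B : Array m n₂} →
  BalancedArray r₁ s A → BalancedArray r₂ s B → BalancedArray (r₁ + r₂) s (A ‖ B)
‖-BalancedArray {n₁ = n₁} {s = s} {A = A} {B} BA BB = record
  { rows = λ i → Balanced-splitAt n₁ [ A i , B i ] (rows BA i) (rows BB i)
  ; cols = λ j → column (splitAt n₁ j) }
  where
  column : ∀ y → Balanced s (λ i → [ A i , B i ] y)
  column (inj₁ j) = cols BA j
  column (inj₂ j) = cols BB j

⊕-BalancedArray : ∀ {m₁ m₂ n₁ n₂ r s} {A : Array m₁ n₁} {B : Array m₂ n₂} →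
  BalancedArray r s A → BalancedArray r s B → BalancedArray r s (A ⊕ B)
⊕-BalancedArray {m₁} {n₁ = n₁} {r = r} {s} {A = A} {B} BA BB = record
  { rows = λ i → row (splitAt m₁ i) ; cols = λ j → column (splitAt n₁ j) }
  where
  row : ∀ y → Balanced r (λ j → [ (λ i → (A i ++ empty) j) , (λ i → (empty ++ B i) j) ] y)
  row (inj₁ i) = Balanced-padʳ (rows BA i)
  row (inj₂ i) = Balanced-padˡ (rows BB i)
  column : ∀ y → Balanced s ((λ i → [ A i , empty ] y) ++ (λ i → [ empty , B i ] y))
  column (inj₁ j) = Balanced-padʳ (cols BA j)
  column (inj₂ j) = Balanced-padˡ (cols BB j)

occ : ∀ {m n} → Array m n → ℤ → ℕ
occ A x = sumℕ (λ i → count (λ j → isEntry x (A i j)))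

isEntry-refl : ∀ x → isEntry x (just x) ≡ true
isEntry-refl x = trans (isYes≗does (x ≟ x)) (dec-true (x ≟ x) refl)

isEntry-≢ : ∀ {x y} → x ≢ y → isEntry x (just y) ≡ false
isEntry-≢ {x} {y} x≢y = trans (isYes≗does (x ≟ y)) (dec-false (x ≟ y) x≢y)

occ-entry : ∀ {m n} (A : Array m n) i j {x} → A i j ≡ just x → 1 ≤ occ A x
occ-entry A i j {x} Aij≡x = ℕ.≤-trans
  (1≤count _ j (subst (λ c → isEntry x c ≡ true) (sym Aij≡x) (isEntry-refl x)))
  (≤-sumℕ (λ i → count (λ j → isEntry x (A i j))) i)

occ-‖ : ∀ {m n₁ n₂} (A : Array m n₁) (B : Array m n₂) x → occ (A ‖ B) x ≡ occ A x + occ B x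
occ-‖ A B x = trans (sumℕ-cong (λ i → count-++ (isEntry x) (A i) (B i)))
                    (sumℕ-+ (λ i → count (λ j → isEntry x (A i j)))
                            (λ i → count (λ j → isEntry x (B i j))))

occ-⊕ : ∀ {m₁ m₂ n₁ n₂} (A : Array m₁ n₁) (B : Array m₂ n₂) x → occ (A ⊕ B) x ≡ occ A x + occ B x
occ-⊕ {m₁} {n₁ = n₁} {n₂} A B x = trans (sumℕ-splitAt m₁ occRow)
  (cong₂ _+_ (sumℕ-cong λ i → trans (count-++ (isEntry x) (A i) (empty {n₂}))
                                    (trans (cong (_+_ _) (count-false {n₂})) (ℕ.+-identityʳ _)))
             (sumℕ-cong λ i → trans (count-++ (isEntry x) (empty {n₁}) (B i))
                                    (cong (λ k → k + _) (count-false {n₁}))))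
  where
  occRow : Fin m₁ ⊎ Fin _ → ℕ
  occRow y = count (λ j → isEntry x ([ (λ i → (A i ++ empty) j) , (λ i → (empty ++ B i) j) ] y))

record UsesEachOnce {m n} (t S : ℕ) (A : Array m n) : Set where
  field
    inside : ∀ x → t < ∣ x ∣ → ∣ x ∣ ≤ S + t → occ A x ≡ 1
    below  : ∀ x → ∣ x ∣ ≤ t → occ A x ≡ 0
    above  : ∀ x → S + t < ∣ x ∣ → occ A x ≡ 0
open UsesEachOnce

UsesEachOnce-entry : ∀ {m n t S} {A : Array m n} → UsesEachOnce t S A →
  ∀ i j {x} → A i j ≡ just x → t < ∣ x ∣ × ∣ x ∣ ≤ S + t
UsesEachOnce-entry {A = A} U i j {x} Aij≡x =
  ℕ.≰⇒> (λ x≤t → absent (below U x x≤t)) , ℕ.≮⇒≥ (λ S+t<x → absent (above U x S+t<x))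
  where
  absent : ¬ occ A x ≡ 0
  absent o = contradiction (subst (1 ≤_) o (occ-entry A i j Aij≡x)) λ ()

UsesEachOnce-none : ∀ {m n t} {A : Array m n} → (∀ x → occ A x ≡ 0) → UsesEachOnce t 0 A
UsesEachOnce-none none = record
  { inside = λ x t<x x≤t → contradiction x≤t (ℕ.<⇒≱ t<x)
  ; below  = λ x _ → none x
  ; above  = λ x _ → none x }

UsesEachOnce-join : ∀ {m n m₁ n₁ m₂ n₂ t S₁ S₂} {A : Array m₁ n₁} {B : Array m₂ n₂} {C : Array m n} →
  UsesEachOnce t S₁ A → UsesEachOnce (S₁ + t) S₂ B →
  (∀ x → occ C x ≡ occ A x + occ B x) → UsesEachOnce t (S₁ + S₂) C
UsesEachOnce-join {t = t} {S₁} {S₂} {C = C} UA UB occC = record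
  { inside = inC
  ; below  = λ x x≤t → trans (occC x)
      (cong₂ _+_ (below UA x x≤t) (below UB x (ℕ.≤-trans x≤t (ℕ.m≤n+m t S₁))))
  ; above  = λ x S+t<x → trans (occC x)
      (cong₂ _+_ (above UA x (ℕ.≤-<-trans (ℕ.+-monoˡ-≤ t (ℕ.m≤m+n S₁ S₂)) S+t<x))
                 (above UB x (subst (_< ∣ x ∣) (reassoc S₁ S₂ t) S+t<x)))
  }
  where
  reassoc : ∀ S₁ S₂ t → (S₁ + S₂) + t ≡ S₂ + (S₁ + t)
  reassoc = ℕ-Solver.solve-∀
  inC : ∀ x → t < ∣ x ∣ → ∣ x ∣ ≤ (S₁ + S₂) + t → occ C x ≡ 1
  inC x t<x x≤S+t with ∣ x ∣ ≤? S₁ + t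
  ... | yes x≤S₁+t = trans (occC x) (cong₂ _+_ (inside UA x t<x x≤S₁+t) (below UB x x≤S₁+t))
  ... | no  x≰S₁+t = trans (occC x) (cong₂ _+_ (above UA x (ℕ.≰⇒> x≰S₁+t))
          (inside UB x (ℕ.≰⇒> x≰S₁+t) (subst (∣ x ∣ ≤_) (reassoc S₁ S₂ t) x≤S+t)))

‖-UsesEachOnce : ∀ {m n₁ n₂ t S₁ S₂} {A : Array m n₁} {B : Array m n₂} →
  UsesEachOnce t S₁ A → UsesEachOnce (S₁ + t) S₂ B → UsesEachOnce t (S₁ + S₂) (A ‖ B)
‖-UsesEachOnce {A = A} {B} UA UB = UsesEachOnce-join UA UB (occ-‖ A B)

⊕-UsesEachOnce : ∀ {m₁ m₂ n₁ n₂ t S₁ S₂} {A : Array m₁ n₁} {B : Array m₂ n₂} →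
  UsesEachOnce t S₁ A → UsesEachOnce (S₁ + t) S₂ B → UsesEachOnce t (S₁ + S₂) (A ⊕ B)
⊕-UsesEachOnce {A = A} {B} UA UB = UsesEachOnce-join UA UB (occ-⊕ A B)

pair : ℤ → Array 2 1
pair v zero    _ = just v
pair v (suc _) _ = just (- v)

∣i∣≡∣j∣⇒i≡j⊎i≡-j : ∀ {i j} → ∣ i ∣ ≡ ∣ j ∣ → i ≡ j ⊎ i ≡ - j
∣i∣≡∣j∣⇒i≡j⊎i≡-j {+ m}         {+ .m}          refl = inj₁ refl
∣i∣≡∣j∣⇒i≡j⊎i≡-j {+ .(suc n)}   { -[1+ n ]}     refl = inj₂ refl
∣i∣≡∣j∣⇒i≡j⊎i≡-j { -[1+ m ]}    {+ .(suc m)}    refl = inj₂ refl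
∣i∣≡∣j∣⇒i≡j⊎i≡-j { -[1+ m ]}    { -[1+ .m ]}    refl = inj₁ refl

i≢-i : ∀ {i n} → ∣ i ∣ ≡ suc n → i ≢ - i
i≢-i {+ zero}     ()
i≢-i {+ suc _}    _ ()
i≢-i { -[1+ _ ]}  _ ()

occ-pair-self : ∀ v → v ≢ - v → occ (pair v) v ≡ 1
occ-pair-self v v≢-v rewrite isEntry-refl v | isEntry-≢ v≢-v = refl

occ-pair-neg : ∀ v → v ≢ - v → occ (pair v) (- v) ≡ 1
occ-pair-neg v v≢-v rewrite isEntry-≢ (v≢-v ∘ sym) | isEntry-refl (- v) = refl

occ-pair-other : ∀ v x → ∣ x ∣ ≢ ∣ v ∣ → occ (pair v) x ≡ 0
occ-pair-other v x x≉v
  rewrite isEntry-≢ {x} {v} (x≉v ∘ cong ∣_∣)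
        | isEntry-≢ {x} { - v} (λ x≡-v → x≉v (trans (cong ∣_∣ x≡-v) (ℤ.∣-i∣≡∣i∣ v))) = refl

pair-UsesEachOnce : ∀ {u} v → ∣ v ∣ ≡ suc u → UsesEachOnce u 1 (pair v)
pair-UsesEachOnce {u} v ∣v∣≡1+u = record
  { inside = once
  ; below  = λ x x≤u → occ-pair-other v x λ x≡v → ℕ.<⇒≱ (u<∣x∣ {x} x≡v) x≤u
  ; above  = λ x 1+u<x → occ-pair-other v x λ x≡v →
      ℕ.<⇒≱ 1+u<x (ℕ.≤-reflexive (trans x≡v ∣v∣≡1+u))
  }
  where
  u<∣x∣ : ∀ {x} → ∣ x ∣ ≡ ∣ v ∣ → u < ∣ x ∣
  u<∣x∣ x≡v = ℕ.≤-reflexive (sym (trans x≡v ∣v∣≡1+u))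
  once : ∀ x → u < ∣ x ∣ → ∣ x ∣ ≤ 1 + u → occ (pair v) x ≡ 1
  once x u<x x≤1+u with ∣i∣≡∣j∣⇒i≡j⊎i≡-j {x} {v} (trans (ℕ.≤-antisym x≤1+u u<x) (sym ∣v∣≡1+u))
  ... | inj₁ refl = occ-pair-self v (i≢-i ∣v∣≡1+u)
  ... | inj₂ refl = occ-pair-neg v (i≢-i ∣v∣≡1+u)

pair-column : ∀ v → Balanced 2 (λ i → pair v i zero)
pair-column v = record
  { filledCount = refl
  ; posNeg      = signs v
  ; sumZero     = trans (cong (_+ℤ_ v) (ℤ.+-identityʳ (- v))) (ℤ.+-inverseʳ v) }
  where
  signs : ∀ v → count (λ i → isPos (pair v i zero)) ≡ count (λ i → isNeg (pair v i zero))
  signs (+ zero)  = refl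
  signs (+ suc _) = refl
  signs -[1+ _ ]  = refl

block : ℕ → Array 2 4
block t = pair (+ suc t) ‖ pair -[1+ 1 + t ] ‖ pair -[1+ 2 + t ] ‖ pair (+ suc (3 + t))

block-BalancedArray : ∀ t → BalancedArray 4 2 (block t)
block-BalancedArray t = record
  { rows = λ { zero       → record { filledCount = refl ; posNeg = refl ; sumZero = row₀ (+ t) }
             ; (suc zero) → record { filledCount = refl ; posNeg = refl ; sumZero = row₁ (+ t) } }
  ; cols = λ { zero                   → pair-column (+ suc t)
             ; (suc zero)             → pair-column -[1+ 1 + t ]
             ; (suc (suc zero))       → pair-column -[1+ 2 + t ]
             ; (suc (suc (suc zero))) → pair-column (+ suc (3 + t)) } }
  where
  row₀ : ∀ p → (+ 1 +ℤ p) +ℤ (- (+ 2 +ℤ p) +ℤ (- (+ 3 +ℤ p) +ℤ ((+ 4 +ℤ p) +ℤ + 0))) ≡ + 0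
  row₀ = ℤ-Solver.solve-∀
  row₁ : ∀ p → - (+ 1 +ℤ p) +ℤ ((+ 2 +ℤ p) +ℤ ((+ 3 +ℤ p) +ℤ (- (+ 4 +ℤ p) +ℤ + 0))) ≡ + 0
  row₁ = ℤ-Solver.solve-∀

block-UsesEachOnce : ∀ t → UsesEachOnce t 4 (block t)
block-UsesEachOnce t =
  ‖-UsesEachOnce (pair-UsesEachOnce (+ suc t) refl)
    (‖-UsesEachOnce (pair-UsesEachOnce -[1+ 1 + t ] refl)
      (‖-UsesEachOnce (pair-UsesEachOnce -[1+ 2 + t ] refl)
        (pair-UsesEachOnce (+ suc (3 + t)) refl)))

‖-replicate : ∀ {m n} (a S : ℕ) → (ℕ → Array m n) → ℕ → Array m (a * n)
‖-replicate zero    S B t = λ _ → empty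
‖-replicate (suc a) S B t = B t ‖ ‖-replicate a S B (S + t)

⊕-replicate : ∀ {m n} (h S : ℕ) → (ℕ → Array m n) → ℕ → Array (h * m) (h * n)
⊕-replicate zero    S B t = λ ()
⊕-replicate (suc h) S B t = B t ⊕ ⊕-replicate h S B (S + t)

‖-replicate-BalancedArray : ∀ {m n r s S} {B : ℕ → Array m n} → (∀ t → BalancedArray r s (B t)) →
  ∀ a t → BalancedArray (a * r) s (‖-replicate a S B t)
‖-replicate-BalancedArray BB zero    t = record { rows = λ _ → Balanced-empty ; cols = λ () }
‖-replicate-BalancedArray BB (suc a) t =
  ‖-BalancedArray (BB t) (‖-replicate-BalancedArray BB a _)

‖-replicate-UsesEachOnce : ∀ {m n S} {B : ℕ → Array m n} → (∀ t → UsesEachOnce t S (B t)) →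
  ∀ a t → UsesEachOnce t (a * S) (‖-replicate a S B t)
‖-replicate-UsesEachOnce {m} UB zero    t = UsesEachOnce-none (λ _ → sumℕ-zero {m})
‖-replicate-UsesEachOnce {S = S} UB (suc a) t =
  ‖-UsesEachOnce (UB t) (‖-replicate-UsesEachOnce UB a (S + t))

⊕-replicate-BalancedArray : ∀ {m n r s S} {B : ℕ → Array m n} → (∀ t → BalancedArray r s (B t)) →
  ∀ h t → BalancedArray r s (⊕-replicate h S B t)
⊕-replicate-BalancedArray BB zero    t = record { rows = λ () ; cols = λ () }
⊕-replicate-BalancedArray BB (suc h) t =
  ⊕-BalancedArray (BB t) (⊕-replicate-BalancedArray BB h _)

⊕-replicate-UsesEachOnce : ∀ {m n S} {B : ℕ → Array m n} → (∀ t → UsesEachOnce t S (B t)) →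
  ∀ h t → UsesEachOnce t (h * S) (⊕-replicate h S B t)
⊕-replicate-UsesEachOnce UB zero    t = UsesEachOnce-none (λ _ → refl)
⊕-replicate-UsesEachOnce {S = S} UB (suc h) t =
  ⊕-UsesEachOnce (UB t) (⊕-replicate-UsesEachOnce UB h (S + t))

BalancedArray⇒SMR : ∀ {m n r s S} {A : Array m n} → BalancedArray r s A → UsesEachOnce 0 S A →
  m * r ≡ n * s → m * r ≡ S * 2 → IsSMR m n r s A × Shiftable A
BalancedArray⇒SMR {m} {r = r} {S = S} BA U mr≡ns mr≡2S = record
  { rowFilled  = filledCount ∘ rows BA
  ; colFilled  = filledCount ∘ cols BA
  ; sizes      = mr≡ns
  ; entriesInX = λ i j x Aij≡x → let (0<x , x≤S) = UsesEachOnce-entry U i j Aij≡x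
                                 in 0<x , subst (∣ x ∣ ≤_) S≡ x≤S
  ; eachOnce   = λ x (1≤x , x≤mr/2) → inside U x 1≤x (subst (∣ x ∣ ≤_) (sym S≡) x≤mr/2)
  ; rowSum     = sumZero ∘ rows BA
  ; colSum     = sumZero ∘ cols BA
  } , (posNeg ∘ rows BA , posNeg ∘ cols BA)
  where
  S≡ : S + 0 ≡ (m * r) / 2
  S≡ = trans (ℕ.+-identityʳ S) (trans (sym (m*n/n≡m S 2)) (cong (_/ 2) (sym mr≡2S)))

lemma16 : (a b : ℕ) → 1 ≤ a → 1 ≤ b →
    Σ (Array (4 * b + 2) (2 * a * (4 * b + 2))) (λ A → IsSMR (4 * b + 2) (2 * a * (4 * b + 2)) (4 * a) 2 A × Shiftable A)
lemma16 a b _ _ = subst₂ SMR (height b) (width a b) (A , BalancedArray⇒SMR balanced values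
                    (sizes a (2 * b)) (sizes a (2 * b)))
  where
  SMR : ℕ → ℕ → Set
  SMR m n = Σ (Array m n) (λ A → IsSMR m n (4 * a) 2 A × Shiftable A)
  h : ℕ
  h = suc (2 * b)
  A : Array (h * 2) (h * (a * 4))
  A = ⊕-replicate h (a * 4) (‖-replicate a 4 block) 0
  balanced : BalancedArray (4 * a) 2 A
  balanced = subst (λ r → BalancedArray r 2 A) (ℕ.*-comm a 4)
    (⊕-replicate-BalancedArray (‖-replicate-BalancedArray block-BalancedArray a) h 0)
  values : UsesEachOnce 0 (h * (a * 4)) A
  values = ⊕-replicate-UsesEachOnce (‖-replicate-UsesEachOnce block-UsesEachOnce a) h 0
  sizes : ∀ a c → suc c * 2 * (4 * a) ≡ suc c * (a * 4) * 2
  sizes = ℕ-Solver.solve-∀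
  height : ∀ b → suc (2 * b) * 2 ≡ 4 * b + 2
  height = ℕ-Solver.solve-∀
  width : ∀ a b → suc (2 * b) * (a * 4) ≡ 2 * a * (4 * b + 2)
  width = ℕ-Solver.solve-∀
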